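{- Let $\alpha\in\mathrm{Comp}(n,s)$ with $\alpha_i\ge\lambda_i$ for all $i\le s$. The number of free pairs for $\alpha$ is \[ \sum_{i\ge1}(s-\alpha'_i)(\alpha'_{i+1}-\lambda'_{i+1})+\mathrm{coinv}(\alpha), \] where $\alpha'_i$ is the number of cells of $[\alpha]$ in column $i$ and $\lambda'$ is the conjugate partition of $\lambda$.
   Context: Setup: $n\ge0$, $\lambda$ a partition of $k\le n$, $s\ge\ell(\lambda)$, $\lambda_i=0$ for $i>\ell(\lambda)$, $\Lambda=(\lambda_1+n-k,\dots,\lambda_s+n-k)$, $K=k+(n-k)s$. $[\Lambda]=\{(i,j):1\le i\le s,1\le j\le\Lambda_i\}$ (row $i$ from the top, column $j$ from the left), $[\lambda]=\{(i,j):1\le j\le\lambda_i\}$. $T:[\Lambda]\to\{1,\dots,K\}$ is the reverse reading order filling: $T(i,j)=\ell$ iff $(i,j)$ is the $\ell$th cell when reading down each column (top to bottom), columns taken from left to right; $T(c)$ is the label of cell $c$. $\mathrm{Comp}(n,s)$ is the set of tuples $(\alpha_1,\dots,\alpha_s)$ of nonnegative integers summing to $n$; $[\alpha]=\{(i,j):1\le i\le s,1\le j\le\alpha_i\}$; $\mathrm{coinv}(\alpha)=\#\{(i,j):1\le i<j\le s,\ \alpha_i<\alpha_j\}$. A free pair for $\alpha$ is a pair of labels $(i,j)$ with $i>j$ such that the cell with label $i$ lies in $[\alpha]\setminus[\lambda]$ and the cell with label $j$ is the leftmost cell of $[\Lambda]\setminus[\alpha]$ in its row. -}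

module Defs where

open import Data.Nat using (ℕ; zero; suc; _+_; _*_; _∸_; _≤_; _≤ᵇ_; _<ᵇ_; _≡ᵇ_)
open import Data.Bool using (Bool; true; false; _∧_; _∨_; not)
open import Data.Fin using (Fin; toℕ)
open import Data.List using (List; []; _∷_; map; concatMap; length; allFin; upTo; filterᵇ; cartesianProduct)
open import Data.Product using (_×_; _,_; proj₁; proj₂)
open import Data.Nat.ListAction using (sum)

-- Rows are indexed by r : Fin s (row number toℕ r + 1, from the top);
-- columns by c : ℕ with 1 ≤ c (column number c, from the left).
Cell : ℕ → Set
Cell s = Fin s × ℕ

count : {A : Set} → (A → Bool) → List A → ℕ
count p xs = length (filterᵇ p xs)

range1 : ℕ → List ℕ
range1 m = map suc (upTo m)

sumFin : (s : ℕ) → (Fin s → ℕ) → ℕ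
sumFin s x = sum (map x (allFin s))

-- λ is weakly decreasing (a partition padded with zeros to length s)
Decreasing : (s : ℕ) → (Fin s → ℕ) → Set
Decreasing s x = (i j : Fin s) → toℕ i ≤ toℕ j → x j ≤ x i

bigΛ : (s n k : ℕ) → (Fin s → ℕ) → Fin s → ℕ
bigΛ s n k lam r = lam r + (n ∸ k)

cells : (s : ℕ) → (Fin s → ℕ) → List (Cell s)
cells s x = concatMap (λ r → map (λ c → (r , c)) (range1 (x r))) (allFin s)

inDiag : (s : ℕ) → (Fin s → ℕ) → Cell s → Bool
inDiag s x (r , c) = (1 ≤ᵇ c) ∧ (c ≤ᵇ x r)

readsAtOrBefore : {s : ℕ} → Cell s → Cell s → Bool
readsAtOrBefore (r' , c') (r , c) = (c' <ᵇ c) ∨ ((c' ≡ᵇ c) ∧ (toℕ r' ≤ᵇ toℕ r))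

-- the reverse reading order filling T of [Λ]: T(cell) = its position in reading order
labelT : (s n k : ℕ) → (Fin s → ℕ) → Cell s → ℕ
labelT s n k lam c = count (λ c' → readsAtOrBefore c' c) (cells s (bigΛ s n k lam))

inSkew : (s : ℕ) → (Fin s → ℕ) → (Fin s → ℕ) → Cell s → Bool
inSkew s α lam c = inDiag s α c ∧ not (inDiag s lam c)

leftmostOutside : (s n k : ℕ) → (Fin s → ℕ) → (Fin s → ℕ) → Cell s → Bool
leftmostOutside s n k lam α (r , c) =
  inDiag s (bigΛ s n k lam) (r , c) ∧ (c ≡ᵇ suc (α r))

-- number of free pairs for α: pairs of labels (i , j), i > j, with the cell
-- labelled i in [α] \ [λ] and the cell labelled j leftmost in [Λ] \ [α] in its row.
-- Since T is a bijection [Λ] → {1..K}, we count pairs of cells of [Λ].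
freePairs : (s n k : ℕ) → (Fin s → ℕ) → (Fin s → ℕ) → ℕ
freePairs s n k lam α =
  count (λ { (a , b) → inSkew s α lam a ∧ leftmostOutside s n k lam α b
                        ∧ (labelT s n k lam b <ᵇ labelT s n k lam a) })
        (cartesianProduct (cells s (bigΛ s n k lam)) (cells s (bigΛ s n k lam)))

conj : (s : ℕ) → (Fin s → ℕ) → ℕ → ℕ
conj s x i = count (λ r → i ≤ᵇ x r) (allFin s)

coinv : (s : ℕ) → (Fin s → ℕ) → ℕ
coinv s α = count (λ { (i , j) → (toℕ i <ᵇ toℕ j) ∧ (α i <ᵇ α j) })
                  (cartesianProduct (allFin s) (allFin s))

-- Σ_{i ≥ 1} (s - α'_i)(α'_{i+1} - λ'_{i+1}); terms with i ≥ n vanish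
-- (α'_{i+1} = 0 since every α_r ≤ n), so we sum over i = 1..n.
colSum : (s n : ℕ) → (Fin s → ℕ) → (Fin s → ℕ) → ℕ
colSum s n lam α =
  sum (map (λ i → (s ∸ conj s α i) * (conj s α (suc i) ∸ conj s lam (suc i))) (range1 n))

-- Index a free pair by its cell a = (r , c) of [α] ∖ [λ] and by the row r′ of its other cell
-- b = (r′ , α r′ + 1), the leftmost cell of [Λ] ∖ [α] in that row.  As T labels [Λ] in reading
-- order, T b < T a says that b lies in an earlier column (α r′ + 1 < c), or in the same column and
-- a higher row (α r′ + 1 = c and r′ < r).  Such a b always exists: then r′ ≠ r, row r has positive
-- excess α r − λ r, and the excesses sum to n − k, so α r′ < λ r′ + (n − k) = Λ r′.
-- Pairs of the first kind are counted column by column: column i + 1 holds α'_{i+1} − λ'_{i+1}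
-- skew cells, and s − α'_i rows have α r′ < i.  For the second kind, (r , α r′ + 1) is a skew cell
-- exactly when α r′ < α r, because λ r ≤ λ r′ ≤ α r′; these are the pairs counted by coinv(α).

module Submission where

open import Defs
open import Data.Bool using (Bool; true; false; _∧_; not; T)
open import Data.Bool.Properties using (∧-zeroʳ; ∧-identityʳ)
open import Data.Empty using (⊥-elim)
open import Data.Fin using (Fin; toℕ)
import Data.Fin.Properties as Fin
open import Data.List using (List; []; _∷_; _++_; map; concatMap; length; upTo; allFin; cartesianProduct)
open import Data.List.Membership.Propositional using (_∈_)
open import Data.List.Membership.Propositional.Properties using (∈-allFin)
open import Data.List.Properties using (length-tabulate; map-applyUpTo)
open import Data.List.Relation.Unary.Any using (here; there)
open import Data.Nat
open import Data.Nat.ListAction using (sum)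
open import Data.Nat.Properties
open import Algebra.Properties.CommutativeSemigroup +-commutativeSemigroup using (interchange)
open import Algebra.Properties.CommutativeSemigroup *-commutativeSemigroup using (x∙yz≈y∙xz)
open import Data.Product using (_×_; _,_)
open import Data.Sum using (_⊎_; inj₁; inj₂)
open import Function using (_∘_; id)
open import Relation.Binary.Definitions using (Transitive; Total; tri<; tri≈; tri>)
open import Relation.Binary.PropositionalEquality
open import Relation.Nullary using (¬_; yes; no)
open import Relation.Nullary.Reflects
  using (Reflects; ofʸ; ofⁿ; det; fromEquivalence; ¬-reflects; _×-reflects_; _⊎-reflects_)

𝟙 : Bool → ℕ
𝟙 true  = 1
𝟙 false = 0

𝟙-∧ : ∀ a b → 𝟙 (a ∧ b) ≡ 𝟙 a * 𝟙 b
𝟙-∧ true  b = sym (+-identityʳ (𝟙 b))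
𝟙-∧ false b = refl

𝟙-mono : ∀ {P Q : Set} {a b} → Reflects P a → Reflects Q b → (P → Q) → 𝟙 a ≤ 𝟙 b
𝟙-mono (ofⁿ _) _        _   = z≤n
𝟙-mono (ofʸ _) (ofʸ _)  _   = ≤-refl
𝟙-mono (ofʸ p) (ofⁿ ¬q) p⇒q = ⊥-elim (¬q (p⇒q p))

𝟙-split : ∀ {a b} → (T b → T a) → 𝟙 a ≡ 𝟙 b + 𝟙 (a ∧ not b)
𝟙-split {a}     {false} _   = cong 𝟙 (sym (∧-identityʳ a))
𝟙-split {true}  {true}  _   = refl
𝟙-split {false} {true}  b⇒a = ⊥-elim (b⇒a _)

𝟙-absorb : ∀ {a b c} → (T a → T c → T b) → 𝟙 a * 𝟙 (b ∧ c) ≡ 𝟙 a * 𝟙 c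
𝟙-absorb {false}                 _   = refl
𝟙-absorb {true} {b}    {false}   _   = cong (λ x → 𝟙 x + 0) (∧-zeroʳ b)
𝟙-absorb {true} {true} {true}    _   = refl
𝟙-absorb {true} {false} {true} a⇒c⇒b = ⊥-elim (a⇒c⇒b _ _)

𝟙-∧-idem : ∀ a b → 𝟙 a * 𝟙 (a ∧ b) ≡ 𝟙 (a ∧ b)
𝟙-∧-idem true  b = +-identityʳ (𝟙 b)
𝟙-∧-idem false b = refl

𝟙-∧-pull : ∀ a b c → 𝟙 ((a ∧ b) ∧ c) ≡ 𝟙 b * 𝟙 (a ∧ c)
𝟙-∧-pull true  b c = 𝟙-∧ b c
𝟙-∧-pull false b c = sym (*-zeroʳ (𝟙 b))

reflects-T : ∀ {P : Set} {b} → Reflects P b → T b → P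
reflects-T (ofʸ p) _ = p

≡ᵇ-reflects-≡ : ∀ m n → Reflects (m ≡ n) (m ≡ᵇ n)
≡ᵇ-reflects-≡ m n = fromEquivalence (≡ᵇ⇒≡ m n) (≡⇒≡ᵇ m n)

<ᵇ-true : ∀ {m n} → m < n → (m <ᵇ n) ≡ true
<ᵇ-true m<n = det (<ᵇ-reflects-< _ _) (ofʸ m<n)

<ᵇ-false : ∀ {m n} → n ≤ m → (m <ᵇ n) ≡ false
<ᵇ-false n≤m = det (<ᵇ-reflects-< _ _) (ofⁿ (≤⇒≯ n≤m))

≡ᵇ-refl : ∀ n → (n ≡ᵇ n) ≡ true
≡ᵇ-refl n = det (≡ᵇ-reflects-≡ n n) (ofʸ refl)

≡ᵇ-false : ∀ {m n} → m ≢ n → (m ≡ᵇ n) ≡ false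
≡ᵇ-false m≢n = det (≡ᵇ-reflects-≡ _ _) (ofⁿ m≢n)

not-≤ᵇ : ∀ m n → not (m ≤ᵇ n) ≡ (n <ᵇ m)
not-≤ᵇ zero          n       = refl
not-≤ᵇ (suc m)       zero    = refl
not-≤ᵇ (suc zero)    (suc n) = refl
not-≤ᵇ (suc (suc m)) (suc n) = not-≤ᵇ (suc m) n

module _ {A : Set} where

  ∑ : (A → ℕ) → List A → ℕ
  ∑ f xs = sum (map f xs)

  infix 6.5 ∑
  syntax ∑ (λ x → e) xs = ∑[ x ∈ xs ] e

  count≡∑𝟙 : ∀ (p : A → Bool) xs → count p xs ≡ ∑[ x ∈ xs ] 𝟙 (p x)
  count≡∑𝟙 p []       = refl
  count≡∑𝟙 p (x ∷ xs) with p x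
  ... | true  = cong suc (count≡∑𝟙 p xs)
  ... | false = count≡∑𝟙 p xs

  ∑-cong : ∀ {f g : A → ℕ} → (∀ x → f x ≡ g x) → ∀ xs → ∑ f xs ≡ ∑ g xs
  ∑-cong f≗g []       = refl
  ∑-cong f≗g (x ∷ xs) = cong₂ _+_ (f≗g x) (∑-cong f≗g xs)

  ∑-cong-∈ : ∀ {f g : A → ℕ} xs → (∀ {x} → x ∈ xs → f x ≡ g x) → ∑ f xs ≡ ∑ g xs
  ∑-cong-∈ []       f≗g = refl
  ∑-cong-∈ (x ∷ xs) f≗g = cong₂ _+_ (f≗g (here refl)) (∑-cong-∈ xs (f≗g ∘ there))

  ∑-++ : ∀ (f : A → ℕ) xs ys → ∑ f (xs ++ ys) ≡ ∑ f xs + ∑ f ys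
  ∑-++ f []       ys = refl
  ∑-++ f (x ∷ xs) ys = trans (cong (f x +_) (∑-++ f xs ys)) (sym (+-assoc (f x) _ _))

  ∑-zero : ∀ xs → ∑[ x ∈ xs ] 0 ≡ 0
  ∑-zero []       = refl
  ∑-zero (x ∷ xs) = ∑-zero xs

  ∑-1 : ∀ xs → ∑[ x ∈ xs ] 1 ≡ length xs
  ∑-1 []       = refl
  ∑-1 (x ∷ xs) = cong suc (∑-1 xs)

  ∑-+ : ∀ (f g : A → ℕ) xs → ∑[ x ∈ xs ] (f x + g x) ≡ ∑ f xs + ∑ g xs
  ∑-+ f g []       = refl
  ∑-+ f g (x ∷ xs) = trans (cong (f x + g x +_) (∑-+ f g xs)) (interchange (f x) (g x) _ _)

  ∑-*ˡ : ∀ k (f : A → ℕ) xs → ∑[ x ∈ xs ] (k * f x) ≡ k * ∑ f xs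
  ∑-*ˡ k f []       = sym (*-zeroʳ k)
  ∑-*ˡ k f (x ∷ xs) = trans (cong (k * f x +_) (∑-*ˡ k f xs)) (sym (*-distribˡ-+ k (f x) _))

  ∑-*ʳ : ∀ k (f : A → ℕ) xs → ∑[ x ∈ xs ] (f x * k) ≡ ∑ f xs * k
  ∑-*ʳ k f xs = trans (∑-cong (λ x → *-comm (f x) k) xs) (trans (∑-*ˡ k f xs) (*-comm k _))

  ∑-mono-≤ : ∀ {f g : A → ℕ} → (∀ x → f x ≤ g x) → ∀ xs → ∑ f xs ≤ ∑ g xs
  ∑-mono-≤ f≤g []       = z≤n
  ∑-mono-≤ f≤g (x ∷ xs) = +-mono-≤ (f≤g x) (∑-mono-≤ f≤g xs)

  ∑-mono-< : ∀ {f g : A → ℕ} {y xs} → (∀ x → f x ≤ g x) → y ∈ xs → f y < g y → ∑ f xs < ∑ g xs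
  ∑-mono-< {xs = x ∷ xs} f≤g (here refl) fy<gy = +-mono-<-≤ fy<gy (∑-mono-≤ f≤g xs)
  ∑-mono-< {xs = x ∷ xs} f≤g (there y∈) fy<gy = +-mono-≤-< (f≤g x) (∑-mono-< f≤g y∈ fy<gy)

  ∈⇒≤∑ : ∀ (f : A → ℕ) {y xs} → y ∈ xs → f y ≤ ∑ f xs
  ∈⇒≤∑ f {xs = x ∷ xs} (here refl) = m≤m+n (f x) _
  ∈⇒≤∑ f {xs = x ∷ xs} (there y∈) = ≤-trans (∈⇒≤∑ f y∈) (m≤n+m _ (f x))

  ∈⇒+≤∑ : ∀ (f : A → ℕ) {y z xs} → y ∈ xs → z ∈ xs → y ≢ z → f y + f z ≤ ∑ f xs
  ∈⇒+≤∑ f (here refl) (here refl) y≢z = ⊥-elim (y≢z refl)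
  ∈⇒+≤∑ f (here refl) (there z∈) _   = +-monoʳ-≤ (f _) (∈⇒≤∑ f z∈)
  ∈⇒+≤∑ f {y} {z} {z ∷ xs} (there y∈) (here refl) _ =
    subst (_≤ f z + ∑ f xs) (+-comm (f z) (f y)) (+-monoʳ-≤ (f z) (∈⇒≤∑ f y∈))
  ∈⇒+≤∑ f {xs = x ∷ xs} (there y∈) (there z∈) y≢z =
    ≤-trans (∈⇒+≤∑ f y∈ z∈ y≢z) (m≤n+m _ (f x))

  ∑𝟙-∸ : ∀ {p q : A → Bool} → (∀ x → T (q x) → T (p x)) → ∀ xs →
    ∑[ x ∈ xs ] 𝟙 (p x) ∸ ∑[ x ∈ xs ] 𝟙 (q x) ≡ ∑[ x ∈ xs ] 𝟙 (p x ∧ not (q x))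
  ∑𝟙-∸ {p} {q} q⇒p xs = begin
    ∑[ x ∈ xs ] 𝟙 (p x) ∸ ∑[ x ∈ xs ] 𝟙 (q x)
      ≡⟨ cong (_∸ ∑q) (∑-cong (λ x → 𝟙-split (q⇒p x)) xs) ⟩
    ∑[ x ∈ xs ] (𝟙 (q x) + 𝟙 (p x ∧ not (q x))) ∸ ∑[ x ∈ xs ] 𝟙 (q x)
      ≡⟨ cong (_∸ ∑q) (∑-+ (𝟙 ∘ q) (λ x → 𝟙 (p x ∧ not (q x))) xs) ⟩
    ∑[ x ∈ xs ] 𝟙 (q x) + ∑[ x ∈ xs ] 𝟙 (p x ∧ not (q x)) ∸ ∑[ x ∈ xs ] 𝟙 (q x)
      ≡⟨ m+n∸m≡n ∑q _ ⟩
    ∑[ x ∈ xs ] 𝟙 (p x ∧ not (q x)) ∎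
    where
    open ≡-Reasoning
    ∑q : ℕ
    ∑q = ∑[ x ∈ xs ] 𝟙 (q x)

∑-map : ∀ {A B : Set} (f : B → ℕ) (g : A → B) xs → ∑ f (map g xs) ≡ ∑ (f ∘ g) xs
∑-map f g []       = refl
∑-map f g (x ∷ xs) = cong (f (g x) +_) (∑-map f g xs)

∑-concatMap : ∀ {A B : Set} (f : B → ℕ) (h : A → List B) xs →
  ∑ f (concatMap h xs) ≡ ∑[ x ∈ xs ] ∑ f (h x)
∑-concatMap f h []       = refl
∑-concatMap f h (x ∷ xs) = trans (∑-++ f (h x) _) (cong (∑ f (h x) +_) (∑-concatMap f h xs))

∑-comm : ∀ {A B : Set} (f : A → B → ℕ) xs ys →
  ∑[ x ∈ xs ] ∑[ y ∈ ys ] f x y ≡ ∑[ y ∈ ys ] ∑[ x ∈ xs ] f x y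
∑-comm f []       ys = sym (∑-zero ys)
∑-comm f (x ∷ xs) ys = trans (cong (∑ (f x) ys +_) (∑-comm f xs ys)) (sym (∑-+ (f x) _ ys))

∑-cartesianProduct : ∀ {A B : Set} (f : A × B → ℕ) xs ys →
  ∑ f (cartesianProduct xs ys) ≡ ∑[ x ∈ xs ] ∑[ y ∈ ys ] f (x , y)
∑-cartesianProduct f []       ys = refl
∑-cartesianProduct f (x ∷ xs) ys = trans (∑-++ f (map (x ,_) ys) _)
  (cong₂ _+_ (∑-map f (x ,_) ys) (∑-cartesianProduct f xs ys))

range1-suc : ∀ m → range1 (suc m) ≡ 1 ∷ map suc (range1 m)
range1-suc m = cong (λ cs → 1 ∷ map suc cs) (sym (map-applyUpTo id suc m))

∑-range1-suc : ∀ (f : ℕ → ℕ) m → ∑ f (range1 (suc m)) ≡ f 1 + ∑[ c ∈ range1 m ] f (suc c)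
∑-range1-suc f m = trans (cong (∑ f) (range1-suc m)) (cong (f 1 +_) (∑-map f suc (range1 m)))

∑-range1-zero : ∀ {f : ℕ → ℕ} → (∀ c → f (suc c) ≡ 0) → ∀ m → ∑ f (range1 m) ≡ 0
∑-range1-zero {f} f≡0 m = trans (∑-map f suc (upTo m)) (trans (∑-cong f≡0 (upTo m)) (∑-zero (upTo m)))

∑-range1-support : ∀ {f : ℕ → ℕ} a m → (∀ c → a ≤ c → f (suc c) ≡ 0) → a ≤ m →
  ∑ f (range1 m) ≡ ∑ f (range1 a)
∑-range1-support zero m f≡0 _ = ∑-range1-zero (λ c → f≡0 c z≤n) m
∑-range1-support {f} (suc a) (suc m) f≡0 (s≤s a≤m) = begin
  ∑ f (range1 (suc m))                   ≡⟨ ∑-range1-suc f m ⟩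
  f 1 + ∑[ c ∈ range1 m ] f (suc c)
    ≡⟨ cong (f 1 +_) (∑-range1-support a m (λ c a≤c → f≡0 (suc c) (s≤s a≤c)) a≤m) ⟩
  f 1 + ∑[ c ∈ range1 a ] f (suc c)      ≡⟨ ∑-range1-suc f a ⟨
  ∑ f (range1 (suc a))                   ∎
  where open ≡-Reasoning

∑-range1-≡ᵇ : ∀ (g : ℕ → ℕ) u m → ∑[ c ∈ range1 m ] 𝟙 (c ≡ᵇ suc u) * g c ≡ 𝟙 (u <ᵇ m) * g (suc u)
∑-range1-≡ᵇ g u       zero    = refl
∑-range1-≡ᵇ g zero    (suc m) = begin
  ∑[ c ∈ range1 (suc m) ] 𝟙 (c ≡ᵇ 1) * g c      ≡⟨ ∑-range1-suc (λ c → 𝟙 (c ≡ᵇ 1) * g c) m ⟩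
  1 * g 1 + ∑[ c ∈ range1 m ] 𝟙 (c ≡ᵇ 0) * g (suc c)
    ≡⟨ cong (1 * g 1 +_) (∑-range1-zero (λ c → refl) m) ⟩
  1 * g 1 + 0                                    ≡⟨ +-identityʳ (1 * g 1) ⟩
  1 * g 1                                        ∎
  where open ≡-Reasoning
∑-range1-≡ᵇ g (suc u) (suc m) =
  trans (∑-range1-suc (λ c → 𝟙 (c ≡ᵇ suc (suc u)) * g c) m) (∑-range1-≡ᵇ (g ∘ suc) u m)

module _ {A : Set} {_≼_ : A → A → Set} (_≼ᵇ_ : A → A → Bool)
         (≼-reflects : ∀ x y → Reflects (x ≼ y) (x ≼ᵇ y))
         (≼-refl : ∀ {x} → x ≼ x) (≼-trans : Transitive _≼_) (≼-total : Total _≼_) where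

  count-≼-<ᵇ : ∀ {a xs} b → a ∈ xs → (count (_≼ᵇ b) xs <ᵇ count (_≼ᵇ a) xs) ≡ not (a ≼ᵇ b)
  count-≼-<ᵇ {a} {xs} b a∈xs rewrite count≡∑𝟙 (_≼ᵇ b) xs | count≡∑𝟙 (_≼ᵇ a) xs
    with a ≼ᵇ b | ≼-reflects a b
  ... | true  | ofʸ a≼b = <ᵇ-false (∑-mono-≤ down-a⊆down-b xs)
    where
    down-a⊆down-b : ∀ x → 𝟙 (x ≼ᵇ a) ≤ 𝟙 (x ≼ᵇ b)
    down-a⊆down-b x = 𝟙-mono (≼-reflects x a) (≼-reflects x b) (λ x≼a → ≼-trans x≼a a≼b)
  ... | false | ofⁿ a⋠b = <ᵇ-true (∑-mono-< down-b⊆down-a a∈xs a∉down-b)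
    where
    b≼a : b ≼ a
    b≼a with ≼-total a b
    ... | inj₁ a≼b = ⊥-elim (a⋠b a≼b)
    ... | inj₂ b≼a = b≼a
    down-b⊆down-a : ∀ x → 𝟙 (x ≼ᵇ b) ≤ 𝟙 (x ≼ᵇ a)
    down-b⊆down-a x = 𝟙-mono (≼-reflects x b) (≼-reflects x a) (λ x≼b → ≼-trans x≼b b≼a)
    a∉down-b : 𝟙 (a ≼ᵇ b) < 𝟙 (a ≼ᵇ a)
    a∉down-b rewrite det (≼-reflects a b) (ofⁿ a⋠b) | det (≼-reflects a a) (ofʸ ≼-refl) = z<s

_⊑_ : ∀ {s} → Cell s → Cell s → Set
(r′ , c′) ⊑ (r , c) = c′ < c ⊎ (c′ ≡ c × toℕ r′ ≤ toℕ r)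

readsAtOrBefore-reflects : ∀ {s} (x y : Cell s) → Reflects (x ⊑ y) (readsAtOrBefore x y)
readsAtOrBefore-reflects (r′ , c′) (r , c) =
  <ᵇ-reflects-< c′ c ⊎-reflects (≡ᵇ-reflects-≡ c′ c ×-reflects ≤ᵇ-reflects-≤ (toℕ r′) (toℕ r))

⊑-refl : ∀ {s} {x : Cell s} → x ⊑ x
⊑-refl = inj₂ (refl , ≤-refl)

⊑-trans : ∀ {s} → Transitive (_⊑_ {s})
⊑-trans (inj₁ c<c′)        (inj₁ c′<c″)        = inj₁ (<-trans c<c′ c′<c″)
⊑-trans (inj₁ c<c′)        (inj₂ (refl , _))   = inj₁ c<c′
⊑-trans (inj₂ (refl , _))  (inj₁ c′<c″)        = inj₁ c′<c″
⊑-trans (inj₂ (refl , r≤r′)) (inj₂ (refl , r′≤r″)) = inj₂ (refl , ≤-trans r≤r′ r′≤r″)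

⊑-total : ∀ {s} → Total (_⊑_ {s})
⊑-total (r′ , c′) (r , c) with <-cmp c′ c
... | tri< c′<c _ _ = inj₁ (inj₁ c′<c)
... | tri> _ _ c<c′ = inj₂ (inj₁ c<c′)
... | tri≈ _ refl _ with ≤-total (toℕ r′) (toℕ r)
...   | inj₁ r′≤r = inj₁ (inj₂ (refl , r′≤r))
...   | inj₂ r≤r′ = inj₂ (inj₂ (refl , r≤r′))

labelT-<ᵇ : ∀ {s} n k lam {a} b → a ∈ cells s (bigΛ s n k lam) →
  (labelT s n k lam b <ᵇ labelT s n k lam a) ≡ not (readsAtOrBefore a b)
labelT-<ᵇ n k lam = count-≼-<ᵇ readsAtOrBefore readsAtOrBefore-reflects ⊑-refl ⊑-trans ⊑-total

𝟙-readsAfter : ∀ {s} (r r′ : Fin s) c t →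
  𝟙 (not (readsAtOrBefore (r , c) (r′ , t))) ≡ 𝟙 (t <ᵇ c) + 𝟙 ((c ≡ᵇ t) ∧ (toℕ r′ <ᵇ toℕ r))
𝟙-readsAfter r r′ c t with <-cmp c t
... | tri< c<t _ _ rewrite <ᵇ-true c<t | <ᵇ-false (<⇒≤ c<t) | ≡ᵇ-false (<⇒≢ c<t) = refl
... | tri≈ _ refl _ rewrite <ᵇ-false (≤-refl {c}) | ≡ᵇ-refl c = cong 𝟙 (not-≤ᵇ (toℕ r) (toℕ r′))
... | tri> _ _ t<c rewrite <ᵇ-false (<⇒≤ t<c) | <ᵇ-true t<c | ≡ᵇ-false (>⇒≢ t<c) = refl

∑-cells : ∀ s (x : Fin s → ℕ) (f : Cell s → ℕ) →
  ∑ f (cells s x) ≡ ∑[ r ∈ allFin s ] ∑[ c ∈ range1 (x r) ] f (r , c)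
∑-cells s x f = trans (∑-concatMap f (λ r → map (r ,_) (range1 (x r))) (allFin s))
                      (∑-cong (λ r → ∑-map f (r ,_) (range1 (x r))) (allFin s))

inSkew-reflects : ∀ {s} (α lam : Fin s → ℕ) r c →
  Reflects ((1 ≤ c × c ≤ α r) × ¬ (1 ≤ c × c ≤ lam r)) (inSkew s α lam (r , c))
inSkew-reflects α lam r c =
  (≤ᵇ-reflects-≤ 1 c ×-reflects ≤ᵇ-reflects-≤ c (α r))
  ×-reflects ¬-reflects (≤ᵇ-reflects-≤ 1 c ×-reflects ≤ᵇ-reflects-≤ c (lam r))

inSkew-sound : ∀ {s} (α lam : Fin s → ℕ) r c → T (inSkew s α lam (r , c)) → lam r < c × c ≤ α r
inSkew-sound α lam r c skew
  with (1≤c , c≤α) , c∉lam ← reflects-T (inSkew-reflects α lam r c) skew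
  = ≰⇒> (λ c≤lam → c∉lam (1≤c , c≤lam)) , c≤α

∑-leftmostOutside : ∀ {s} n k (lam α : Fin s → ℕ) r′ (p : ℕ → Bool) →
  ∑[ c ∈ range1 (bigΛ s n k lam r′) ] 𝟙 (leftmostOutside s n k lam α (r′ , c) ∧ p c)
    ≡ 𝟙 ((α r′ <ᵇ bigΛ s n k lam r′) ∧ p (suc (α r′)))
∑-leftmostOutside {s} n k lam α r′ p = begin
  ∑[ c ∈ range1 (Λ r′) ] 𝟙 ((inDiag s Λ (r′ , c) ∧ (c ≡ᵇ suc (α r′))) ∧ p c)
    ≡⟨ ∑-cong (λ c → 𝟙-∧-pull (inDiag s Λ (r′ , c)) (c ≡ᵇ suc (α r′)) (p c)) (range1 (Λ r′)) ⟩
  ∑[ c ∈ range1 (Λ r′) ] 𝟙 (c ≡ᵇ suc (α r′)) * 𝟙 (inDiag s Λ (r′ , c) ∧ p c)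
    ≡⟨ ∑-range1-≡ᵇ (λ c → 𝟙 (inDiag s Λ (r′ , c) ∧ p c)) (α r′) (Λ r′) ⟩
  𝟙 (α r′ <ᵇ Λ r′) * 𝟙 ((α r′ <ᵇ Λ r′) ∧ p (suc (α r′)))
    ≡⟨ 𝟙-∧-idem (α r′ <ᵇ Λ r′) (p (suc (α r′))) ⟩
  𝟙 ((α r′ <ᵇ Λ r′) ∧ p (suc (α r′))) ∎
  where
  open ≡-Reasoning
  Λ : Fin s → ℕ
  Λ = bigΛ s n k lam

s∸conj : ∀ s (x : Fin s → ℕ) i → s ∸ conj s x i ≡ ∑[ r ∈ allFin s ] 𝟙 (x r <ᵇ i)
s∸conj s x i = begin
  s ∸ conj s x i
    ≡⟨ cong₂ _∸_ (trans (sym (length-tabulate id)) (sym (∑-1 (allFin s))))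
                 (count≡∑𝟙 (λ r → i ≤ᵇ x r) (allFin s)) ⟩
  ∑[ r ∈ allFin s ] 1 ∸ ∑[ r ∈ allFin s ] 𝟙 (i ≤ᵇ x r)
    ≡⟨ ∑𝟙-∸ {p = λ _ → true} (λ _ _ → _) (allFin s) ⟩
  ∑[ r ∈ allFin s ] 𝟙 (not (i ≤ᵇ x r))
    ≡⟨ ∑-cong (λ r → cong 𝟙 (not-≤ᵇ i (x r))) (allFin s) ⟩
  ∑[ r ∈ allFin s ] 𝟙 (x r <ᵇ i) ∎
  where open ≡-Reasoning

conj-∸-conj : ∀ {s} (α lam : Fin s → ℕ) → (∀ r → lam r ≤ α r) → ∀ i →
  conj s α (suc i) ∸ conj s lam (suc i) ≡ ∑[ r ∈ allFin s ] 𝟙 (inSkew s α lam (r , suc i))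
conj-∸-conj {s} α lam lam≤α i =
  trans (cong₂ _∸_ (count≡∑𝟙 (λ r → suc i ≤ᵇ α r) (allFin s))
                   (count≡∑𝟙 (λ r → suc i ≤ᵇ lam r) (allFin s)))
        (∑𝟙-∸ (λ r i<lam → ≤⇒≤ᵇ (≤-trans (≤ᵇ⇒≤ (suc i) (lam r) i<lam) (lam≤α r))) (allFin s))

module FreePairCount {s : ℕ} (n k : ℕ) (lam α : Fin s → ℕ) (lam≤α : ∀ r → lam r ≤ α r)
                     (∑lam≡k : sumFin s lam ≡ k) (∑α≡n : sumFin s α ≡ n) where

  private
    Λ : Fin s → ℕ
    Λ = bigΛ s n k lam

  excess : Fin s → ℕ
  excess r = α r ∸ lam r

  α≡lam+excess : ∀ r → α r ≡ lam r + excess r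
  α≡lam+excess r = sym (m+[n∸m]≡n (lam≤α r))

  ∑excess : sumFin s excess ≡ n ∸ k
  ∑excess = begin
    sumFin s excess
      ≡⟨ m+n∸m≡n (sumFin s lam) _ ⟨
    sumFin s lam + sumFin s excess ∸ sumFin s lam
      ≡⟨ cong (_∸ sumFin s lam) (∑-+ lam excess (allFin s)) ⟨
    ∑[ r ∈ allFin s ] (lam r + excess r) ∸ sumFin s lam
      ≡⟨ cong₂ _∸_ (∑-cong (λ r → sym (α≡lam+excess r)) (allFin s)) ∑lam≡k ⟩
    sumFin s α ∸ k
      ≡⟨ cong (_∸ k) ∑α≡n ⟩
    n ∸ k ∎
    where open ≡-Reasoning

  α≤Λ : ∀ r → α r ≤ Λ r
  α≤Λ r = subst (_≤ Λ r) (sym (α≡lam+excess r))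
    (+-monoʳ-≤ (lam r) (subst (excess r ≤_) ∑excess (∈⇒≤∑ excess (∈-allFin r))))

  α≤n : ∀ r → α r ≤ n
  α≤n r = subst (α r ≤_) ∑α≡n (∈⇒≤∑ α (∈-allFin r))

  α<Λ : ∀ {r c r′} → lam r < c → c ≤ α r → α r′ < c → α r′ < Λ r′
  α<Λ {r} {c} {r′} lam<c c≤α α′<c with r Fin.≟ r′
  ... | yes refl = ⊥-elim (≤⇒≯ c≤α α′<c)
  ... | no r≢r′  = begin-strict
    α r′                  ≡⟨ α≡lam+excess r′ ⟩
    lam r′ + excess r′    <⟨ +-monoʳ-< (lam r′) excess′<n∸k ⟩
    lam r′ + (n ∸ k)      ∎
    where
    open ≤-Reasoning
    excess′<n∸k : excess r′ < n ∸ k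
    excess′<n∸k = ≤-trans (+-monoˡ-≤ (excess r′) (m<n⇒0<n∸m (<-≤-trans lam<c c≤α)))
                          (subst (excess r + excess r′ ≤_) ∑excess
                                 (∈⇒+≤∑ excess (∈-allFin r) (∈-allFin r′) r≢r′))

  leftmostOutside-exists : ∀ a r′ → T (inSkew s α lam a) →
    T (not (readsAtOrBefore a (r′ , suc (α r′)))) → T (α r′ <ᵇ Λ r′)
  leftmostOutside-exists (r , c) r′ skew after
    with lam<c , c≤α ← inSkew-sound α lam r c skew
    = <⇒<ᵇ (α<Λ lam<c c≤α (≰⇒> λ c≤α′ → a⋢b (inj₁ (s≤s c≤α′))))
    where
    a⋢b : ¬ (r , c) ⊑ (r′ , suc (α r′))
    a⋢b = reflects-T (¬-reflects (readsAtOrBefore-reflects (r , c) (r′ , suc (α r′)))) after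

  ∑cellRow : (Fin s → ℕ → Fin s → ℕ) → ℕ
  ∑cellRow f = ∑[ r ∈ allFin s ] ∑[ c ∈ range1 (Λ r) ] ∑[ r′ ∈ allFin s ] f r c r′

  ∑cellRow-cong : ∀ {f g} → (∀ r c r′ → f r c r′ ≡ g r c r′) → ∑cellRow f ≡ ∑cellRow g
  ∑cellRow-cong f≡g =
    ∑-cong (λ r → ∑-cong (λ c → ∑-cong (f≡g r c) (allFin s)) (range1 (Λ r))) (allFin s)

  ∑cellRow-+ : ∀ f g → ∑cellRow (λ r c r′ → f r c r′ + g r c r′) ≡ ∑cellRow f + ∑cellRow g
  ∑cellRow-+ f g = trans
    (∑-cong (λ r → trans (∑-cong (λ c → ∑-+ (f r c) (g r c) (allFin s)) (range1 (Λ r)))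
                         (∑-+ _ _ (range1 (Λ r)))) (allFin s))
    (∑-+ _ _ (allFin s))

  freePairsAcrossColumns : ℕ
  freePairsAcrossColumns =
    ∑cellRow (λ r c r′ → 𝟙 (inSkew s α lam (r , c)) * 𝟙 (suc (α r′) <ᵇ c))

  freePairsWithinColumns : ℕ
  freePairsWithinColumns =
    ∑cellRow (λ r c r′ → 𝟙 (inSkew s α lam (r , c)) * 𝟙 ((c ≡ᵇ suc (α r′)) ∧ (toℕ r′ <ᵇ toℕ r)))

  freePairsFrom : ∀ {a} → a ∈ cells s Λ →
    ∑[ b ∈ cells s Λ ] 𝟙 (inSkew s α lam a ∧ leftmostOutside s n k lam α b
                          ∧ (labelT s n k lam b <ᵇ labelT s n k lam a))
      ≡ ∑[ r′ ∈ allFin s ] 𝟙 (inSkew s α lam a) * 𝟙 (not (readsAtOrBefore a (r′ , suc (α r′))))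
  freePairsFrom {a} a∈ = begin
    ∑[ b ∈ cells s Λ ] 𝟙 (skew ∧ leftmostOutside s n k lam α b
                          ∧ (labelT s n k lam b <ᵇ labelT s n k lam a))
      ≡⟨ ∑-cong (λ b → trans (cong (λ x → 𝟙 (skew ∧ leftmostOutside s n k lam α b ∧ x))
                                   (labelT-<ᵇ n k lam b a∈))
                             (𝟙-∧ skew _)) (cells s Λ) ⟩
    ∑[ b ∈ cells s Λ ] 𝟙 skew * 𝟙 (leftmostOutside s n k lam α b ∧ after b)
      ≡⟨ ∑-*ˡ (𝟙 skew) _ (cells s Λ) ⟩
    𝟙 skew * (∑[ b ∈ cells s Λ ] 𝟙 (leftmostOutside s n k lam α b ∧ after b))
      ≡⟨ cong (𝟙 skew *_) (trans (∑-cells s Λ _)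
           (∑-cong (λ r′ → ∑-leftmostOutside n k lam α r′ (λ c → after (r′ , c))) (allFin s))) ⟩
    𝟙 skew * (∑[ r′ ∈ allFin s ] 𝟙 ((α r′ <ᵇ Λ r′) ∧ after (r′ , suc (α r′))))
      ≡⟨ ∑-*ˡ (𝟙 skew) _ (allFin s) ⟨
    ∑[ r′ ∈ allFin s ] 𝟙 skew * 𝟙 ((α r′ <ᵇ Λ r′) ∧ after (r′ , suc (α r′)))
      ≡⟨ ∑-cong (λ r′ → 𝟙-absorb (leftmostOutside-exists a r′)) (allFin s) ⟩
    ∑[ r′ ∈ allFin s ] 𝟙 skew * 𝟙 (after (r′ , suc (α r′))) ∎
    where
    open ≡-Reasoning
    skew : Bool
    skew = inSkew s α lam a
    after : Cell s → Bool
    after b = not (readsAtOrBefore a b)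

  freePairs-split : freePairs s n k lam α ≡ freePairsAcrossColumns + freePairsWithinColumns
  freePairs-split = begin
    freePairs s n k lam α
      ≡⟨ trans (count≡∑𝟙 _ (cartesianProduct (cells s Λ) (cells s Λ)))
               (∑-cartesianProduct _ (cells s Λ) (cells s Λ)) ⟩
    ∑[ a ∈ cells s Λ ] ∑[ b ∈ cells s Λ ] 𝟙 (inSkew s α lam a ∧ leftmostOutside s n k lam α b
                                               ∧ (labelT s n k lam b <ᵇ labelT s n k lam a))
      ≡⟨ ∑-cong-∈ (cells s Λ) freePairsFrom ⟩
    ∑[ a ∈ cells s Λ ] ∑[ r′ ∈ allFin s ]
      𝟙 (inSkew s α lam a) * 𝟙 (not (readsAtOrBefore a (r′ , suc (α r′))))
      ≡⟨ ∑-cells s Λ _ ⟩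
    ∑cellRow (λ r c r′ → 𝟙 (inSkew s α lam (r , c)) * 𝟙 (not (readsAtOrBefore (r , c) (r′ , suc (α r′)))))
      ≡⟨ ∑cellRow-cong split ⟩
    ∑cellRow (λ r c r′ → 𝟙 (inSkew s α lam (r , c)) * 𝟙 (suc (α r′) <ᵇ c)
                         + 𝟙 (inSkew s α lam (r , c)) * 𝟙 ((c ≡ᵇ suc (α r′)) ∧ (toℕ r′ <ᵇ toℕ r)))
      ≡⟨ ∑cellRow-+ _ _ ⟩
    freePairsAcrossColumns + freePairsWithinColumns ∎
    where
    open ≡-Reasoning
    split : ∀ r c r′ → 𝟙 (inSkew s α lam (r , c)) * 𝟙 (not (readsAtOrBefore (r , c) (r′ , suc (α r′))))
      ≡ 𝟙 (inSkew s α lam (r , c)) * 𝟙 (suc (α r′) <ᵇ c)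
        + 𝟙 (inSkew s α lam (r , c)) * 𝟙 ((c ≡ᵇ suc (α r′)) ∧ (toℕ r′ <ᵇ toℕ r))
    split r c r′ = trans (cong (𝟙 (inSkew s α lam (r , c)) *_) (𝟙-readsAfter r r′ c (suc (α r′))))
                         (*-distribˡ-+ (𝟙 (inSkew s α lam (r , c))) _ _)

  -- Reindex by c = i + 1: column 1 contributes nothing, and row r has no skew cell
  -- beyond column α r ≤ min (Λ r) n.
  ∑-row-acrossColumns : ∀ r →
    ∑[ c ∈ range1 (Λ r) ] 𝟙 (inSkew s α lam (r , c)) * (∑[ r′ ∈ allFin s ] 𝟙 (suc (α r′) <ᵇ c))
      ≡ ∑[ i ∈ range1 n ] 𝟙 (inSkew s α lam (r , suc i)) * (∑[ r′ ∈ allFin s ] 𝟙 (α r′ <ᵇ i))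
  ∑-row-acrossColumns r = begin
    ∑ F (range1 (Λ r))                  ≡⟨ ∑-range1-support (α r) (Λ r) beyondRow (α≤Λ r) ⟩
    ∑ F (range1 (α r))                  ≡⟨ ∑-range1-support (α r) (suc n) beyondRow (m≤n⇒m≤1+n (α≤n r)) ⟨
    ∑ F (range1 (suc n))                ≡⟨ ∑-range1-suc F n ⟩
    F 1 + ∑[ i ∈ range1 n ] F (suc i)   ≡⟨ cong (_+ ∑[ i ∈ range1 n ] F (suc i)) F1≡0 ⟩
    ∑[ i ∈ range1 n ] F (suc i)         ∎
    where
    open ≡-Reasoning
    F : ℕ → ℕ
    F c = 𝟙 (inSkew s α lam (r , c)) * (∑[ r′ ∈ allFin s ] 𝟙 (suc (α r′) <ᵇ c))
    beyondRow : ∀ x → α r ≤ x → F (suc x) ≡ 0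
    beyondRow x α≤x =
      cong (λ b → 𝟙 (b ∧ not (x <ᵇ lam r)) * (∑[ r′ ∈ allFin s ] 𝟙 (α r′ <ᵇ x))) (<ᵇ-false α≤x)
    F1≡0 : F 1 ≡ 0
    F1≡0 = trans (cong (𝟙 (inSkew s α lam (r , 1)) *_) (∑-zero (allFin s)))
                 (*-zeroʳ (𝟙 (inSkew s α lam (r , 1))))

  colSum≡freePairsAcrossColumns : colSum s n lam α ≡ freePairsAcrossColumns
  colSum≡freePairsAcrossColumns = begin
    colSum s n lam α
      ≡⟨ ∑-cong (λ i → cong₂ _*_ (s∸conj s α i) (conj-∸-conj α lam lam≤α i)) (range1 n) ⟩
    ∑[ i ∈ range1 n ] (shorter i * (∑[ r ∈ allFin s ] 𝟙 (inSkew s α lam (r , suc i))))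
      ≡⟨ ∑-cong (λ i → trans (*-comm (shorter i) _) (sym (∑-*ʳ (shorter i) _ (allFin s)))) (range1 n) ⟩
    ∑[ i ∈ range1 n ] ∑[ r ∈ allFin s ] 𝟙 (inSkew s α lam (r , suc i)) * shorter i
      ≡⟨ ∑-comm _ (range1 n) (allFin s) ⟩
    ∑[ r ∈ allFin s ] ∑[ i ∈ range1 n ] 𝟙 (inSkew s α lam (r , suc i)) * shorter i
      ≡⟨ ∑-cong ∑-row-acrossColumns (allFin s) ⟨
    ∑[ r ∈ allFin s ] ∑[ c ∈ range1 (Λ r) ]
      𝟙 (inSkew s α lam (r , c)) * (∑[ r′ ∈ allFin s ] 𝟙 (suc (α r′) <ᵇ c))
      ≡⟨ ∑-cong (λ r → ∑-cong (λ c → ∑-*ˡ (𝟙 (inSkew s α lam (r , c))) _ (allFin s))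
                              (range1 (Λ r))) (allFin s) ⟨
    freePairsAcrossColumns ∎
    where
    open ≡-Reasoning
    shorter : ℕ → ℕ
    shorter i = ∑[ r′ ∈ allFin s ] 𝟙 (α r′ <ᵇ i)

  sameColumn≡inversion : Decreasing s lam → ∀ r r′ →
    𝟙 (α r′ <ᵇ Λ r) * (𝟙 ((α r′ <ᵇ α r) ∧ not (α r′ <ᵇ lam r)) * 𝟙 (toℕ r′ <ᵇ toℕ r))
      ≡ 𝟙 ((toℕ r′ <ᵇ toℕ r) ∧ (α r′ <ᵇ α r))
  sameColumn≡inversion lam-dec r r′ with toℕ r′ <ᵇ toℕ r | <ᵇ-reflects-< (toℕ r′) (toℕ r)
  ... | false | _ = trans (cong (𝟙 (α r′ <ᵇ Λ r) *_) (*-zeroʳ (𝟙 ((α r′ <ᵇ α r) ∧ not (α r′ <ᵇ lam r)))))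
                          (*-zeroʳ (𝟙 (α r′ <ᵇ Λ r)))
  ... | true  | ofʸ r′<r rewrite <ᵇ-false (≤-trans (lam-dec r′ r (<⇒≤ r′<r)) (lam≤α r′))
    with α r′ <ᵇ α r | <ᵇ-reflects-< (α r′) (α r)
  ...   | false | _        = *-zeroʳ (𝟙 (α r′ <ᵇ Λ r))
  ...   | true  | ofʸ α′<α rewrite <ᵇ-true (<-≤-trans α′<α (α≤Λ r)) = refl

  coinv≡freePairsWithinColumns : Decreasing s lam → coinv s α ≡ freePairsWithinColumns
  coinv≡freePairsWithinColumns lam-dec = begin
    coinv s α
      ≡⟨ trans (count≡∑𝟙 _ (cartesianProduct (allFin s) (allFin s)))
               (∑-cartesianProduct _ (allFin s) (allFin s)) ⟩
    ∑[ r′ ∈ allFin s ] ∑[ r ∈ allFin s ] 𝟙 ((toℕ r′ <ᵇ toℕ r) ∧ (α r′ <ᵇ α r))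
      ≡⟨ ∑-comm _ (allFin s) (allFin s) ⟩
    ∑[ r ∈ allFin s ] ∑[ r′ ∈ allFin s ] 𝟙 ((toℕ r′ <ᵇ toℕ r) ∧ (α r′ <ᵇ α r))
      ≡⟨ ∑-cong (λ r → ∑-cong (sameColumn≡inversion lam-dec r) (allFin s)) (allFin s) ⟨
    ∑[ r ∈ allFin s ] ∑[ r′ ∈ allFin s ]
      𝟙 (α r′ <ᵇ Λ r) * (𝟙 (inSkew s α lam (r , suc (α r′))) * 𝟙 (toℕ r′ <ᵇ toℕ r))
      ≡⟨ ∑-cong (λ r → ∑-cong (λ r′ → ∑-range1-≡ᵇ (λ c → 𝟙 (inSkew s α lam (r , c)) * 𝟙 (toℕ r′ <ᵇ toℕ r))
                                                   (α r′) (Λ r)) (allFin s)) (allFin s) ⟨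
    ∑[ r ∈ allFin s ] ∑[ r′ ∈ allFin s ] ∑[ c ∈ range1 (Λ r) ]
      𝟙 (c ≡ᵇ suc (α r′)) * (𝟙 (inSkew s α lam (r , c)) * 𝟙 (toℕ r′ <ᵇ toℕ r))
      ≡⟨ ∑-cong (λ r → ∑-comm _ (allFin s) (range1 (Λ r))) (allFin s) ⟩
    ∑cellRow (λ r c r′ → 𝟙 (c ≡ᵇ suc (α r′)) * (𝟙 (inSkew s α lam (r , c)) * 𝟙 (toℕ r′ <ᵇ toℕ r)))
      ≡⟨ ∑cellRow-cong (λ r c r′ → regroup (c ≡ᵇ suc (α r′)) (inSkew s α lam (r , c)) (toℕ r′ <ᵇ toℕ r)) ⟩
    freePairsWithinColumns ∎
    where
    open ≡-Reasoning
    regroup : ∀ a b c → 𝟙 a * (𝟙 b * 𝟙 c) ≡ 𝟙 b * 𝟙 (a ∧ c)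
    regroup a b c = trans (x∙yz≈y∙xz (𝟙 a) (𝟙 b) (𝟙 c)) (cong (𝟙 b *_) (sym (𝟙-∧ a c)))

lemma4p5 : (n k s : ℕ) (lam : Fin s → ℕ) (α : Fin s → ℕ)
    → Decreasing s lam → sumFin s lam ≡ k → k ≤ n
    → sumFin s α ≡ n → ((i : Fin s) → lam i ≤ α i)
    → freePairs s n k lam α ≡ colSum s n lam α + coinv s α
lemma4p5 n k s lam α lam-dec ∑lam≡k _ ∑α≡n lam≤α = begin
  freePairs s n k lam α                             ≡⟨ freePairs-split ⟩
  freePairsAcrossColumns + freePairsWithinColumns   ≡⟨ cong₂ _+_ (sym colSum≡freePairsAcrossColumns)
                                                                  (sym (coinv≡freePairsWithinColumns lam-dec)) ⟩
  colSum s n lam α + coinv s α                      ∎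
  where
  open ≡-Reasoning
  open FreePairCount n k lam α lam≤α ∑lam≡k ∑α≡n
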